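{- Let $G$ be a bipartite graph with maximum degree $\Delta(G) \geq 2$. Then $$\frac{i(G)}{\gamma(G)} \leq \frac{\Delta(G)}{2}.$$
   Context: All graphs are simple, undirected and finite. A set $D \subseteq V(G)$ is a dominating set of $G$ if every vertex of $V(G)\setminus D$ is adjacent to at least one vertex of $D$; the domination number $\gamma(G)$ is the minimum cardinality of a dominating set of $G$. A set $I \subseteq V(G)$ is an independent dominating set if it is both an independent set (no two of its vertices are adjacent) and a dominating set; the independent domination number $i(G)$ is the minimum cardinality of an independent dominating set of $G$. $\Delta(G)$ denotes the maximum degree of $G$. -}

module Defs where

open import Data.Nat using (ℕ; zero; suc; _⊔_; _+_)
open import Data.Bool using (Bool; true; false; T; _≟_)
open import Data.Fin using (Fin)
open import Data.Fin.Subset using (Subset; _∈_; _∉_; ∣_∣)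
open import Data.Vec.Functional using (foldr)
open import Data.Product using (Σ; ∃; _×_; _,_)
open import Relation.Binary.PropositionalEquality using (_≡_; _≢_)
open import Relation.Nullary using (¬_)

record Graph (n : ℕ) : Set where
  field
    adj   : Fin n → Fin n → Bool
    sym   : ∀ u v → adj u v ≡ adj v u
    irrefl : ∀ v → adj v v ≡ false
open Graph public

Adj : ∀ {n} → Graph n → Fin n → Fin n → Set
Adj G u v = T (adj G u v)

degree : ∀ {n} → Graph n → Fin n → ℕ
degree G v = foldr (λ b k → (if b then suc k else k)) 0 (adj G v)
  where open import Data.Bool using (if_then_else_)

maxDegree : ∀ {n} → Graph n → ℕ
maxDegree G = foldr (λ d m → d ⊔ m) 0 (degree G)

Bipartite : ∀ {n} → Graph n → Set
Bipartite {n} G = Σ (Fin n → Bool) λ c → ∀ u v → Adj G u v → c u ≢ c v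

Dominating : ∀ {n} → Graph n → Subset n → Set
Dominating {n} G D = ∀ v → v ∉ D → ∃ λ u → u ∈ D × Adj G v u

Independent : ∀ {n} → Graph n → Subset n → Set
Independent G I = ∀ u v → u ∈ I → v ∈ I → ¬ Adj G u v

IndependentDominating : ∀ {n} → Graph n → Subset n → Set
IndependentDominating G I = Independent G I × Dominating G I

IsDominationNumber : ∀ {n} → Graph n → ℕ → Set
IsDominationNumber G k =
  (∃ λ D → Dominating G D × ∣ D ∣ ≡ k) × (∀ D → Dominating G D → k Data.Nat.≤ ∣ D ∣)

IsIndepDominationNumber : ∀ {n} → Graph n → ℕ → Set
IsIndepDominationNumber G k =
  (∃ λ I → IndependentDominating G I × ∣ I ∣ ≡ k)
  × (∀ I → IndependentDominating G I → k Data.Nat.≤ ∣ I ∣)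

module Submission where

-- Fix a proper 2-colouring with classes A and B and a minimum dominating set D.
-- From D we build an independent dominating set I with
--     |I| ≤ |D ∩ A| + (Δ − 1)·|D ∩ B|:
-- Y is the set of vertices of B without a neighbour in D ∩ A, and
--     I = (D ∩ A) ∪ Y ∪ U,   U = vertices of A − D without a neighbour in Y.
-- Every vertex of Y lies in D (its dominator would be in D ∩ A), and every vertex of U
-- is dominated by a vertex of D ∩ B that has a neighbour in D ∩ A; such a vertex
-- therefore has at most Δ − 1 neighbours in U.  Double counting bounds |U|.
-- Exchanging the roles of A and B gives the mirror bound, and adding the two yields
--     2·i(G) ≤ Δ·(|D ∩ A| + |D ∩ B|) = Δ·γ(G).

open import Defs hiding (sym)
open import Data.Nat using (ℕ; zero; suc; _+_; _*_; _∸_; _⊔_; _≤_; z≤n; s≤s)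
open import Data.Nat.Properties
open import Data.Nat.Solver using (module +-*-Solver)
open import Data.Bool using (Bool; true; false; T; _∧_; _∨_; not; if_then_else_)
open import Data.Bool.Properties
  using (∨-zeroʳ; ∨-conicalʳ; ∧-zeroʳ; ∧-conicalˡ; ∧-conicalʳ; not-injective; not-involutive; ¬-not; T-≡)
open import Data.Fin using (Fin; zero; suc)
open import Data.Fin.Subset using (Subset; _∈_; ∣_∣)
open import Data.Vec using ([]; _∷_; lookup; tabulate)
open import Data.Vec.Properties using ([]=⇒lookup; lookup⇒[]=; lookup∘tabulate)
open import Data.Vec.Functional using (foldr)
open import Data.Product using (∃; _×_; _,_)
open import Data.Sum using (_⊎_; inj₁; inj₂)
open import Data.Empty using (⊥; ⊥-elim)
open import Relation.Nullary using (¬_)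
open import Function using (_∘_; Equivalence)
open import Relation.Binary.PropositionalEquality
  using (_≡_; _≢_; refl; sym; trans; cong; subst)
open import Algebra.Properties.Semiring.Sum +-*-semiring
  using (sum; sum-cong-≗; ∑-comm; ∑-distrib-+; *-distribʳ-sum; sum-replicate-zero)

∧-intro : ∀ {x y} → x ≡ true → y ≡ true → x ∧ y ≡ true
∧-intro refl refl = refl

∨-true : ∀ {x y} → x ∨ y ≡ true → x ≡ true ⊎ y ≡ true
∨-true {true}  _ = inj₁ refl
∨-true {false} h = inj₂ h

not-true : ∀ {x} → not x ≡ true → x ≡ false
not-true = not-injective

not-false : ∀ {x} → not x ≡ false → x ≡ true
not-false = not-injective

clash : ∀ {x} → x ≡ true → x ≡ false → ⊥
clash refl ()

bool-cases : ∀ x → x ≡ true ⊎ x ≡ false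
bool-cases true  = inj₁ refl
bool-cases false = inj₂ refl

if-then : ∀ {a} {x y : Bool} → a ≡ true → (if a then x else y) ≡ x
if-then refl = refl

if-else : ∀ {a} {x y : Bool} → a ≡ false → (if a then x else y) ≡ y
if-else refl = refl

opposite : ∀ {x y} → x ≡ not y → (x ≡ true × y ≡ false) ⊎ (y ≡ true × x ≡ false)
opposite {true}  {false} _ = inj₁ (refl , refl)
opposite {false} {true}  _ = inj₂ (refl , refl)

sum-mono : ∀ {n} {f g : Fin n → ℕ} → (∀ v → f v ≤ g v) → sum f ≤ sum g
sum-mono {zero}  f≤g = z≤n
sum-mono {suc n} f≤g = +-mono-≤ (f≤g zero) (sum-mono (f≤g ∘ suc))

term≤sum : ∀ {n} (f : Fin n → ℕ) v → f v ≤ sum f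
term≤sum f zero    = m≤m+n (f zero) _
term≤sum f (suc v) = ≤-trans (term≤sum (f ∘ suc) v) (m≤n+m _ (f zero))

𝟙 : Bool → ℕ
𝟙 true  = 1
𝟙 false = 0

count : ∀ {n} → (Fin n → Bool) → ℕ
count p = sum (λ v → 𝟙 (p v))

𝟙-≤ : ∀ b {k} → (b ≡ true → 1 ≤ k) → 𝟙 b ≤ k
𝟙-≤ false h = z≤n
𝟙-≤ true  h = h refl

count-pos : ∀ {n} (p : Fin n → Bool) v → p v ≡ true → 1 ≤ count p
count-pos p v pv = subst (λ b → 𝟙 b ≤ count p) pv (term≤sum (λ w → 𝟙 (p w)) v)

count-mono : ∀ {n} (p q : Fin n → Bool) → (∀ v → p v ≡ true → q v ≡ true) → count p ≤ count q
count-mono p q p⊆q = sum-mono (λ v → 𝟙-≤ (p v) (λ pv → ≤-reflexive (cong 𝟙 (sym (p⊆q v pv)))))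

count-partition : ∀ {n} (q p : Fin n → Bool) →
  count p ≡ count (λ v → q v ∧ p v) + count (λ v → not (q v) ∧ p v)
count-partition q p = trans (sum-cong-≗ (λ v → split (q v) (p v)))
                            (∑-distrib-+ (λ v → 𝟙 (q v ∧ p v)) (λ v → 𝟙 (not (q v) ∧ p v)))
  where
  split : ∀ a b → 𝟙 b ≡ 𝟙 (a ∧ b) + 𝟙 (not a ∧ b)
  split true  b = sym (+-identityʳ (𝟙 b))
  split false b = refl

count-guard : ∀ {n} a (p : Fin n → Bool) → count (λ v → a ∧ p v) ≡ 𝟙 a * count p
count-guard {n} false p = sum-replicate-zero n
count-guard     true  p = sym (+-identityʳ (count p))

count-cover : ∀ {m n} (R : Fin m → Fin n → Bool) (S : Fin m → Bool) (U : Fin n → Bool) k →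
  (∀ v → U v ≡ true → ∃ λ b → S b ≡ true × R b v ≡ true) →
  (∀ b → S b ≡ true → count (λ v → U v ∧ R b v) ≤ k) →
  count U ≤ count S * k
count-cover {m} {n} R S U k covered fibre = begin
  count U                                ≤⟨ sum-mono each-covered ⟩
  sum (λ v → count (λ b → W b v))        ≡⟨ ∑-comm (λ v b → 𝟙 (W b v)) ⟩
  sum (λ b → count (W b))                ≤⟨ sum-mono fibre-bound ⟩
  sum (λ b → 𝟙 (S b) * k)                ≡⟨ *-distribʳ-sum k (λ b → 𝟙 (S b)) ⟨
  count S * k                            ∎
  where
  open ≤-Reasoning
  W : Fin m → Fin n → Bool
  W b v = S b ∧ (U v ∧ R b v)
  each-covered : ∀ v → 𝟙 (U v) ≤ count (λ b → W b v)
  each-covered v = 𝟙-≤ (U v) λ uv →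
    let (b , sb , rbv) = covered v uv
    in count-pos (λ b → W b v) b (∧-intro sb (∧-intro uv rbv))
  fibre-bound : ∀ b → count (W b) ≤ 𝟙 (S b) * k
  fibre-bound b = ≤-trans (≤-reflexive (count-guard (S b) (λ v → U v ∧ R b v))) (guarded (S b) (fibre b))
    where
    guarded : ∀ a {x} → (a ≡ true → x ≤ k) → 𝟙 a * x ≤ 𝟙 a * k
    guarded false h = z≤n
    guarded true  h = *-monoʳ-≤ 1 (h refl)

some : ∀ {n} → (Fin n → Bool) → Bool
some {zero}  p = false
some {suc n} p = p zero ∨ some (p ∘ suc)

some-intro : ∀ {n} (p : Fin n → Bool) v → p v ≡ true → some p ≡ true
some-intro p zero    pv rewrite pv = refl
some-intro p (suc v) pv rewrite some-intro (p ∘ suc) v pv = ∨-zeroʳ (p zero)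

some-elim : ∀ {n} (p : Fin n → Bool) → some p ≡ true → ∃ λ v → p v ≡ true
some-elim {suc n} p h with ∨-true {p zero} h
... | inj₁ p0 = zero , p0
... | inj₂ ps = let (v , pv) = some-elim (p ∘ suc) ps in suc v , pv

∣∣≡count : ∀ {n} (p : Subset n) → ∣ p ∣ ≡ count (lookup p)
∣∣≡count []          = refl
∣∣≡count (true ∷ p)  = cong suc (∣∣≡count p)
∣∣≡count (false ∷ p) = ∣∣≡count p

∣tabulate∣ : ∀ {n} (p : Fin n → Bool) → ∣ tabulate p ∣ ≡ count p
∣tabulate∣ p = trans (∣∣≡count (tabulate p)) (sum-cong-≗ (cong 𝟙 ∘ lookup∘tabulate p))

∈-tabulate : ∀ {n} {p : Fin n → Bool} {v} → v ∈ tabulate p → p v ≡ true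
∈-tabulate {p = p} {v} h = trans (sym (lookup∘tabulate p v)) ([]=⇒lookup h)

tabulate-∈ : ∀ {n} {p : Fin n → Bool} {v} → p v ≡ true → v ∈ tabulate p
tabulate-∈ {p = p} {v} h = lookup⇒[]= v (tabulate p) (trans (lookup∘tabulate p v) h)

∉-tabulate : ∀ {n} {p : Fin n → Bool} {v} → ¬ v ∈ tabulate p → p v ≡ false
∉-tabulate {p = p} {v} v∉ with bool-cases (p v)
... | inj₁ pv = ⊥-elim (v∉ (tabulate-∈ pv))
... | inj₂ pv = pv

T→≡ : ∀ {x} → T x → x ≡ true
T→≡ = Equivalence.to T-≡

≡→T : ∀ {x} → x ≡ true → T x
≡→T = Equivalence.from T-≡

degree≡count : ∀ {n} (G : Graph n) v → degree G v ≡ count (adj G v)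
degree≡count G v = go (adj G v)
  where
  go : ∀ {m} (f : Fin m → Bool) → foldr (λ b k → if b then suc k else k) 0 f ≡ count f
  go {zero}  f = refl
  go {suc m} f with f zero
  ... | true  = cong suc (go (f ∘ suc))
  ... | false = go (f ∘ suc)

degree≤maxDegree : ∀ {n} (G : Graph n) v → degree G v ≤ maxDegree G
degree≤maxDegree G = go (degree G)
  where
  go : ∀ {m} (f : Fin m → ℕ) v → f v ≤ foldr _⊔_ 0 f
  go f zero    = m≤m⊔n (f zero) _
  go f (suc v) = ≤-trans (go (f ∘ suc) v) (m≤n⊔m (f zero) _)

proper⇒alternating : ∀ {n} (G : Graph n) {c : Fin n → Bool} → (∀ u v → Adj G u v → c u ≢ c v) →
  ∀ u v → adj G u v ≡ true → c u ≡ not (c v)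
proper⇒alternating G c-proper u v e = ¬-not (c-proper u v (≡→T e))

complement-proper : ∀ {n} (G : Graph n) {c : Fin n → Bool} → (∀ u v → Adj G u v → c u ≢ c v) →
  ∀ u v → Adj G u v → not (c u) ≢ not (c v)
complement-proper G c-proper u v e eq = c-proper u v e (not-injective eq)

dominating-lookup : ∀ {n} (G : Graph n) (D : Subset n) → Dominating G D →
  ∀ v → lookup D v ≡ false → ∃ λ u → lookup D u ≡ true × adj G v u ≡ true
dominating-lookup G D D-dom v dv =
  let (u , u∈D , e) = D-dom v (λ v∈D → clash ([]=⇒lookup v∈D) dv)
  in u , []=⇒lookup u∈D , T→≡ e

-- Parameters: a colouring c that alternates along edges (class A: c = true, class
-- B: c = false) and a dominating set d, both as Boolean predicates.
module OneClass {n} (G : Graph n) (c : Fin n → Bool)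
  (alternating : ∀ u v → adj G u v ≡ true → c u ≡ not (c v))
  (d : Fin n → Bool)
  (dominating : ∀ v → d v ≡ false → ∃ λ u → d u ≡ true × adj G v u ≡ true) where

  Δ : ℕ
  Δ = maxDegree G

  DA DB : Fin n → Bool
  DA v = c v ∧ d v
  DB v = not (c v) ∧ d v

  seesDA : Fin n → Bool
  seesDA v = some (λ u → DA u ∧ adj G v u)

  Y : Fin n → Bool
  Y v = not (c v) ∧ not (seesDA v)

  seesY : Fin n → Bool
  seesY v = some (λ u → Y u ∧ adj G v u)

  I : Fin n → Bool
  I v = if c v then d v ∨ not (seesY v) else not (seesDA v)

  U S L : Fin n → Bool
  U v = c v ∧ not (d v) ∧ not (seesY v)
  S v = seesDA v ∧ DB v
  L v = not (seesDA v) ∧ DB v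

  across : ∀ {u v} → adj G v u ≡ true → c u ≡ not (c v)
  across {u} {v} e = alternating u v (trans (Graph.sym G u v) e)

  seesDA-intro : ∀ {u v} → c u ≡ true → d u ≡ true → adj G v u ≡ true → seesDA v ≡ true
  seesDA-intro {u} cu du e = some-intro _ u (∧-intro (∧-intro cu du) e)

  DA-parts : ∀ {v} → DA v ≡ true → c v ≡ true × d v ≡ true
  DA-parts dv = ∧-conicalˡ _ _ dv , ∧-conicalʳ _ _ dv

  Y-parts : ∀ {v} → Y v ≡ true → c v ≡ false × seesDA v ≡ false
  Y-parts yv = not-true (∧-conicalˡ _ _ yv) , not-true (∧-conicalʳ _ _ yv)

  U-parts : ∀ {v} → U v ≡ true → c v ≡ true × d v ≡ false × seesY v ≡ false
  U-parts {v} uv =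
    let rest = ∧-conicalʳ (c v) _ uv
    in ∧-conicalˡ _ _ uv , not-true (∧-conicalˡ _ _ rest) , not-true (∧-conicalʳ _ _ rest)

  Y-intro : ∀ {v} → c v ≡ false → seesDA v ≡ false → Y v ≡ true
  Y-intro cv sv = ∧-intro (cong not cv) (cong not sv)

  -- Y ⊆ D: the dominator of a vertex of Y outside D would be a neighbour in D ∩ A.
  Y⊆D : ∀ v → Y v ≡ true → d v ≡ true
  Y⊆D v yv with bool-cases (d v)
  ... | inj₁ dv = dv
  ... | inj₂ dv =
    let (cv , sv) = Y-parts yv
        (u , du , e) = dominating v dv
    in ⊥-elim (clash (seesDA-intro (trans (across e) (cong not cv)) du e) sv)

  Y⊆L : ∀ v → Y v ≡ true → L v ≡ true
  Y⊆L v yv = let (cv , sv) = Y-parts yv in ∧-intro (cong not sv) (∧-intro (cong not cv) (Y⊆D v yv))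

  I-in-A : ∀ {v} → c v ≡ true → I v ≡ true → d v ≡ true ⊎ seesY v ≡ false
  I-in-A cv iv with ∨-true (trans (sym (if-then cv)) iv)
  ... | inj₁ dv      = inj₁ dv
  ... | inj₂ v-blind = inj₂ (not-true v-blind)

  I-in-B : ∀ {v} → c v ≡ false → I v ≡ true → seesDA v ≡ false
  I-in-B cv iv = not-true (trans (sym (if-else cv)) iv)

  I-out-A : ∀ {v} → c v ≡ true → I v ≡ false → seesY v ≡ true
  I-out-A {v} cv iv = not-false (∨-conicalʳ (d v) _ (trans (sym (if-then cv)) iv))

  I-out-B : ∀ {v} → c v ≡ false → I v ≡ false → seesDA v ≡ true
  I-out-B cv iv = not-false (trans (sym (if-else cv)) iv)

  -- I is independent: an edge of G joins some u ∈ A to some v ∈ B, and v ∈ I means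
  -- v ∈ Y; then u ∈ D would give v a neighbour in D ∩ A, and u ∉ D means u sees Y.
  I-edge-AB : ∀ {u v} → c u ≡ true → c v ≡ false → I u ≡ true → I v ≡ true → adj G u v ≡ true → ⊥
  I-edge-AB {u} {v} cu cv iu iv e with I-in-A cu iu
  ... | inj₁ du      = clash (seesDA-intro cu du (trans (Graph.sym G v u) e)) (I-in-B cv iv)
  ... | inj₂ u-blind =
    clash (some-intro (λ w → Y w ∧ adj G u w) v (∧-intro (Y-intro cv (I-in-B cv iv)) e)) u-blind

  I-independent : ∀ u v → I u ≡ true → I v ≡ true → adj G u v ≡ true → ⊥
  I-independent u v iu iv e with opposite (alternating u v e)
  ... | inj₁ (cu , cv) = I-edge-AB cu cv iu iv e
  ... | inj₂ (cv , cu) = I-edge-AB cv cu iv iu (trans (Graph.sym G v u) e)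

  -- I is dominating: a vertex of B outside I sees D ∩ A ⊆ I, and a vertex of A outside
  -- I sees Y ⊆ I.
  I-dominating : ∀ v → I v ≡ false → ∃ λ u → I u ≡ true × adj G v u ≡ true
  I-dominating v iv with bool-cases (c v)
  ... | inj₁ cv =
    let (u , hu) = some-elim (λ u → Y u ∧ adj G v u) (I-out-A cv iv)
        (cu , su) = Y-parts (∧-conicalˡ (Y u) _ hu)
    in u , trans (if-else cu) (cong not su) , ∧-conicalʳ (Y u) _ hu
  ... | inj₂ cv =
    let (u , hu) = some-elim (λ u → DA u ∧ adj G v u) (I-out-B cv iv)
        (cu , du) = DA-parts (∧-conicalˡ (DA u) _ hu)
    in u , trans (if-then cu) (cong (_∨ not (seesY u)) du) , ∧-conicalʳ (DA u) _ hu

  I-independent-dominating : IndependentDominating G (tabulate I)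
  I-independent-dominating =
      (λ u v u∈I v∈I e → I-independent u v (∈-tabulate u∈I) (∈-tabulate v∈I) (T→≡ e))
    , λ v v∉I → let (u , iu , e) = I-dominating v (∉-tabulate v∉I)
                in u , tabulate-∈ iu , ≡→T e

  -- A vertex of U is dominated by a vertex b of D ∩ B, and b has a neighbour in D ∩ A
  -- (otherwise b ∈ Y and the vertex would see Y); so b ∈ S.
  U-covered : ∀ v → U v ≡ true → ∃ λ b → S b ≡ true × adj G b v ≡ true
  U-covered v uv =
    let (cv , dv , v-blind) = U-parts uv
        (b , db , e) = dominating v dv
        cb = trans (across e) (cong not cv)
    in b , ∧-intro (sees b cb e v-blind) (∧-intro (cong not cb) db) , trans (Graph.sym G b v) e
    where
    sees : ∀ b → c b ≡ false → adj G v b ≡ true → seesY v ≡ false → seesDA b ≡ true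
    sees b cb e v-blind with bool-cases (seesDA b)
    ... | inj₁ b-sees = b-sees
    ... | inj₂ b-blind =
      ⊥-elim (clash (some-intro (λ u → Y u ∧ adj G v u) b (∧-intro (Y-intro cb b-blind) e)) v-blind)

  U-outside-D : ∀ {u} → d u ≡ true → U u ≡ false
  U-outside-D {u} du rewrite du = ∧-zeroʳ (c u)

  -- A vertex b of S has a neighbour in D ∩ A, which is not in U; so at most Δ − 1 of
  -- its at most Δ neighbours lie in U.
  S-fibre : ∀ b → S b ≡ true → count (λ v → U v ∧ adj G b v) ≤ Δ ∸ 1
  S-fibre b sb = m+n≤o⇒m≤o∸n inU (begin
    inU + 1                                                ≤⟨ +-monoʳ-≤ inU one-outside ⟩
    inU + count (λ v → not (U v) ∧ adj G b v)              ≡⟨ count-partition U (adj G b) ⟨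
    count (adj G b)                                        ≡⟨ degree≡count G b ⟨
    degree G b                                             ≤⟨ degree≤maxDegree G b ⟩
    Δ                                                      ∎)
    where
    open ≤-Reasoning
    inU : ℕ
    inU = count (λ v → U v ∧ adj G b v)
    one-outside : 1 ≤ count (λ v → not (U v) ∧ adj G b v)
    one-outside =
      let (u , hu) = some-elim (λ u → DA u ∧ adj G b u) (∧-conicalˡ _ _ sb)
          (_ , du) = DA-parts (∧-conicalˡ (DA u) _ hu)
      in count-pos _ u (∧-intro (cong not (U-outside-D du)) (∧-conicalʳ (DA u) _ hu))

  U-bound : count U ≤ count S * (Δ ∸ 1)
  U-bound = count-cover (adj G) S U (Δ ∸ 1) U-covered S-fibre

  I-cover : ∀ v → 𝟙 (I v) ≤ 𝟙 (DA v) + (𝟙 (U v) + 𝟙 (Y v))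
  I-cover v = table (c v) (d v) (seesDA v) (seesY v)
    where
    table : ∀ a x s t → 𝟙 (if a then x ∨ not t else not s)
                        ≤ 𝟙 (a ∧ x) + (𝟙 (a ∧ not x ∧ not t) + 𝟙 (not a ∧ not s))
    table true  true  s t     = s≤s z≤n
    table true  false s true  = z≤n
    table true  false s false = s≤s z≤n
    table false x     true  t = z≤n
    table false x     false t = s≤s z≤n

  -- |I| ≤ |D ∩ A| + (Δ − 1)·|D ∩ B|, using Y ⊆ L and Δ − 1 ≥ 1 to absorb L.
  I-bound : 2 ≤ Δ → count I ≤ count DA + count DB * (Δ ∸ 1)
  I-bound 2≤Δ = begin
    count I                                         ≤⟨ sum-mono I-cover ⟩
    sum (λ v → 𝟙 (DA v) + (𝟙 (U v) + 𝟙 (Y v)))      ≡⟨ sum-+₃ ⟩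
    count DA + (count U + count Y)                  ≤⟨ +-monoʳ-≤ (count DA) (+-mono-≤ U-bound Y-bound) ⟩
    count DA + (count S * k + count L * k)          ≡⟨ cong (count DA +_) (*-distribʳ-+ k (count S) (count L)) ⟨
    count DA + (count S + count L) * k              ≡⟨ cong (λ m → count DA + m * k) (count-partition seesDA DB) ⟨
    count DA + count DB * k                         ∎
    where
    open ≤-Reasoning
    k : ℕ
    k = Δ ∸ 1
    sum-+₃ : sum (λ v → 𝟙 (DA v) + (𝟙 (U v) + 𝟙 (Y v))) ≡ count DA + (count U + count Y)
    sum-+₃ = trans (∑-distrib-+ (λ v → 𝟙 (DA v)) _) (cong (count DA +_) (∑-distrib-+ (λ v → 𝟙 (U v)) _))
    Y-bound : count Y ≤ count L * k
    Y-bound = begin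
      count Y       ≤⟨ count-mono Y L Y⊆L ⟩
      count L       ≡⟨ *-identityʳ (count L) ⟨
      count L * 1   ≤⟨ *-monoʳ-≤ (count L) (∸-monoˡ-≤ 1 2≤Δ) ⟩
      count L * k   ∎

  i-bound : 2 ≤ Δ → ∀ i → (∀ J → IndependentDominating G J → i ≤ ∣ J ∣) →
    i ≤ count DA + count DB * (Δ ∸ 1)
  i-bound 2≤Δ i i-min = begin
    i                  ≤⟨ i-min (tabulate I) I-independent-dominating ⟩
    ∣ tabulate I ∣     ≡⟨ ∣tabulate∣ I ⟩
    count I            ≤⟨ I-bound 2≤Δ ⟩
    count DA + count DB * (Δ ∸ 1) ∎
    where open ≤-Reasoning

add-bounds : ∀ {Δ i a b} → 1 ≤ Δ → i ≤ a + b * (Δ ∸ 1) → i ≤ b + a * (Δ ∸ 1) →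
  2 * i ≤ Δ * (a + b)
add-bounds {suc k} {i} {a} {b} _ ha hb = begin
  2 * i                             ≤⟨ +-mono-≤ ha (+-mono-≤ hb z≤n) ⟩
  (a + b * k) + ((b + a * k) + 0)   ≡⟨ solve 3 (λ a b k → (a :+ b :* k) :+ ((b :+ a :* k) :+ con 0)
                                                        := (con 1 :+ k) :* (a :+ b)) refl a b k ⟩
  suc k * (a + b)                   ∎
  where
  open ≤-Reasoning
  open +-*-Solver

theorem3 : ∀ {n} (G : Graph n) → Bipartite G → 2 ≤ maxDegree G →
    ∀ (γ i : ℕ) → IsDominationNumber G γ → IsIndepDominationNumber G i →
    2 * i ≤ maxDegree G * γ
theorem3 {n} G (c , c-proper) 2≤Δ γ i ((D , D-dom , ∣D∣≡γ) , _) (_ , i-min) = begin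
  2 * i                                ≤⟨ add-bounds {a = count A.DA} {b = count A.DB}
                                                     (≤-trans (s≤s z≤n) 2≤Δ) bound-A bound-B ⟩
  Δ * (count A.DA + count A.DB)        ≡⟨ cong (Δ *_) (trans (sym (count-partition c d)) ∣D∣≡count) ⟩
  Δ * γ                                ∎
  where
  open ≤-Reasoning
  Δ : ℕ
  Δ = maxDegree G
  d : Fin n → Bool
  d = lookup D
  ∣D∣≡count : count d ≡ γ
  ∣D∣≡count = trans (sym (∣∣≡count D)) ∣D∣≡γ
  module A = OneClass G c (proper⇒alternating G c-proper) d (dominating-lookup G D D-dom)
  module B = OneClass G (not ∘ c) (proper⇒alternating G (complement-proper G c-proper)) d
                      (dominating-lookup G D D-dom)
  bound-A : i ≤ count A.DA + count A.DB * (Δ ∸ 1)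
  bound-A = A.i-bound 2≤Δ i i-min
  -- For the complementary colouring the roles of D ∩ A and D ∩ B are exchanged.
  bound-B : i ≤ count A.DB + count A.DA * (Δ ∸ 1)
  bound-B = subst (λ m → i ≤ count A.DB + m * (Δ ∸ 1)) flipped (B.i-bound 2≤Δ i i-min)
    where
    flipped : count B.DB ≡ count A.DA
    flipped = sum-cong-≗ (λ v → cong (λ x → 𝟙 (x ∧ d v)) (not-involutive (c v)))
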